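{- Let $\Gamma\Rightarrow A$ be an $\mathsf{acLL}^+_\Sigma$ sequent, where the signature $\Sigma$ may include labels licensing $\mathsf{A1}$ and $\mathsf{A2}$. If $\vdash(\widehat{\Gamma}^{\perp},\widehat{A})$ is provable in $\mathsf{CacLL}_\Sigma$, then $\Gamma\Rightarrow A$ is provable in $\mathsf{acLL}^+_\Sigma$.
   Context: $\mathsf{CacLL}_\Sigma$ is the one-sided classical non-associative non-commutative linear logic with subexponentials over a signature $\Sigma=(I,\preceq,f)$, $f:I\to 2^{\{\mathsf{C},\mathsf{W},\mathsf{A1},\mathsf{A2},\mathsf{E}\}}$ upward closed; sequents $\vdash\Gamma$ with binary-tree structures, connectives $\otimes$, par $⅋$, $\oplus$, with $\mathbin{\&}$, units, subexponentials $!^i,?^i$, top-level exchange/associativity, and $?$-licensed structural rules. $\mathsf{acLL}_\Sigma$ is the intuitionistic two-sided counterpart with sequents $\Gamma\Rightarrow A$ (structure antecedent, single succedent) and connectives $\mathbin{\&},\oplus,\otimes,\to,\leftarrow,\top,!^i,\mathsf{1}$. $\mathsf{acLL}^+_\Sigma$ consists of all rules of $\mathsf{acLL}_\Sigma$ except its two associativity rules, plus the six rules (each from premise to conclusion within a context $\Gamma\{\}$, succedent $G$): A1L from $((!^{a1}\Delta_1,\Delta_2),\Delta_3)$ to $(!^{a1}\Delta_1,(\Delta_2,\Delta_3))$; A1M from $(\Delta_1,(!^{a1}\Delta_2,\Delta_3))$ to $((\Delta_1,!^{a1}\Delta_2),\Delta_3)$; A1R from $((\Delta_1,\Delta_2),!^{a1}\Delta_3)$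 to $(\Delta_1,(\Delta_2,!^{a1}\Delta_3))$; A2L from $(!^{a2}\Delta_1,(\Delta_2,\Delta_3))$ to $((!^{a2}\Delta_1,\Delta_2),\Delta_3)$; A2M from $((\Delta_1,!^{a2}\Delta_2),\Delta_3)$ to $(\Delta_1,(!^{a2}\Delta_2,\Delta_3))$; A2R from $(\Delta_1,(\Delta_2,!^{a2}\Delta_3))$ to $((\Delta_1,\Delta_2),!^{a2}\Delta_3)$, where $\mathsf{A1}\in f(a1)$, $\mathsf{A2}\in f(a2)$. The translation: $\widehat{p}=p$, $\widehat{A\otimes B}=\widehat{A}\otimes\widehat{B}$, $\widehat{A\to B}=\widehat{A}^{\perp}⅋\widehat{B}$, $\widehat{B\leftarrow A}=\widehat{B}⅋\widehat{A}^{\perp}$, $\widehat{A\mathbin{\&}B}=\widehat{A}\mathbin{\&}\widehat{B}$, $\widehat{A\oplus B}=\widehat{A}\oplus\widehat{B}$, $\widehat{!^iA}=!^i\widehat{A}$, $\widehat{\mathsf{1}}=\mathsf{1}$, $\widehat{\top}=\top$, with $\widehat{(\Gamma,\Delta)}^{\perp}=(\widehat{\Delta}^{\perp},\widehat{\Gamma}^{\perp})$ on structures. -}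

module Defs where

open import Data.Nat using (ℕ)
open import Data.Bool using (Bool; true)
open import Data.Maybe using (Maybe; just; nothing)
open import Data.Product using (Σ; _×_; _,_)
open import Data.Unit using (⊤)
open import Relation.Binary.PropositionalEquality using (_≡_)
open import Relation.Binary.Structures using (IsPreorder)

data SRule : Set where
  C W A1 A2 E : SRule

record Signature : Set₁ where
  field
    Label      : Set
    _≼_        : Label → Label → Set
    ≼-preorder : IsPreorder _≡_ _≼_
    -- f : I → 2^{C,W,A1,A2,E}, a subset being given by its characteristic function
    f          : Label → SRule → Bool
    f-upward   : ∀ {i j} (s : SRule) → i ≼ j → f i s ≡ true → f j s ≡ true

-- Structures: binary trees, possibly empty.  The empty structure is a
-- unit for the comma: (Γ , ∅) = (∅ , Γ) = Γ.

data Tree (A : Set) : Set where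
  leaf : A → Tree A
  _⊛_  : Tree A → Tree A → Tree A

Str : Set → Set
Str A = Maybe (Tree A)

infixr 5 _,,_
_,,_ : ∀ {A} → Str A → Str A → Str A
nothing ,, y       = y
just x  ,, nothing = just x
just x  ,, just y  = just (x ⊛ y)

⟨_⟩ : ∀ {A} → A → Str A
⟨ a ⟩ = just (leaf a)

data Ctx (A : Set) : Set where
  hole : Ctx A
  _◂_  : Ctx A → Str A → Ctx A
  _▸_  : Str A → Ctx A → Ctx A

_[_] : ∀ {A} → Ctx A → Str A → Str A
hole    [ s ] = s
(c ◂ d) [ s ] = (c [ s ]) ,, d
(d ▸ c) [ s ] = d ,, (c [ s ])

data AllLeaves {A : Set} (P : A → Set) : Tree A → Set where
  leafₐ : ∀ {a} → P a → AllLeaves P (leaf a)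
  nodeₐ : ∀ {t u} → AllLeaves P t → AllLeaves P u → AllLeaves P (t ⊛ u)

AllS : ∀ {A : Set} (P : A → Set) → Str A → Set
AllS P nothing  = ⊤
AllS P (just t) = AllLeaves P t

data IFm (L : Set) : Set where
  var   : ℕ → IFm L
  _&_   : IFm L → IFm L → IFm L
  _⊕_   : IFm L → IFm L → IFm L
  _⊗_   : IFm L → IFm L → IFm L
  _⇾_   : IFm L → IFm L → IFm L
  _⇽_   : IFm L → IFm L → IFm L
  𝟙     : IFm L
  ⊤'    : IFm L
  !_[_] : L → IFm L → IFm L

data CFm (L : Set) : Set where
  pos   : ℕ → CFm L
  neg   : ℕ → CFm L
  _⊗_   : CFm L → CFm L → CFm L
  _⅋_   : CFm L → CFm L → CFm L
  _⊕_   : CFm L → CFm L → CFm L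
  _&_   : CFm L → CFm L → CFm L
  𝟙 ⊥' ⊤' 𝟘 : CFm L
  !_[_] : L → CFm L → CFm L
  ¿_[_] : L → CFm L → CFm L

-- linear negation (De Morgan; order reversed for the multiplicatives)
_ᗮ : ∀ {L} → CFm L → CFm L
pos p ᗮ     = neg p
neg p ᗮ     = pos p
(A ⊗ B) ᗮ   = (B ᗮ) ⅋ (A ᗮ)
(A ⅋ B) ᗮ   = (B ᗮ) ⊗ (A ᗮ)
(A ⊕ B) ᗮ   = (A ᗮ) & (B ᗮ)
(A & B) ᗮ   = (A ᗮ) ⊕ (B ᗮ)
𝟙 ᗮ         = ⊥'
⊥' ᗮ        = 𝟙
⊤' ᗮ        = 𝟘
𝟘 ᗮ         = ⊤'
(! i [ A ]) ᗮ = ¿ i [ A ᗮ ]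
(¿ i [ A ]) ᗮ = ! i [ A ᗮ ]

hat : ∀ {L} → IFm L → CFm L
hat (var p)     = pos p
hat (A & B)     = hat A & hat B
hat (A ⊕ B)     = hat A ⊕ hat B
hat (A ⊗ B)     = hat A ⊗ hat B
hat (A ⇾ B)     = (hat A ᗮ) ⅋ hat B
hat (B ⇽ A)     = hat B ⅋ (hat A ᗮ)
hat 𝟙           = 𝟙
hat ⊤'          = ⊤'
hat (! i [ A ]) = ! i [ hat A ]

hatᗮT : ∀ {L} → Tree (IFm L) → Tree (CFm L)
hatᗮT (leaf A) = leaf (hat A ᗮ)
hatᗮT (t ⊛ u)  = hatᗮT u ⊛ hatᗮT t

hatᗮ : ∀ {L} → Str (IFm L) → Str (CFm L)
hatᗮ nothing  = nothing
hatᗮ (just t) = just (hatᗮT t)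

module _ (𝕊 : Signature) where
  open Signature 𝕊

  IsBangI : Label → IFm Label → Set
  IsBangI i F = Σ (IFm Label) λ B → F ≡ ! i [ B ]

  IsBangUpI : Label → IFm Label → Set
  IsBangUpI i F = Σ Label λ j → Σ (IFm Label) λ B → i ≼ j × F ≡ ! j [ B ]

  record BangI (r : SRule) : Set where
    constructor bangI
    field
      lab  : Label
      lic  : f lab r ≡ true
      tree : Tree (IFm Label)
      ok   : AllLeaves (IsBangI lab) tree

  !S : ∀ {r} → BangI r → Str (IFm Label)
  !S b = just (BangI.tree b)

  infix 3 _⊢⁺_
  data _⊢⁺_ : Str (IFm Label) → IFm Label → Set where
    init : ∀ {A} → ⟨ A ⟩ ⊢⁺ A
    𝟙L   : ∀ {c G} → c [ nothing ] ⊢⁺ G → c [ ⟨ 𝟙 ⟩ ] ⊢⁺ G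
    𝟙R   : nothing ⊢⁺ 𝟙
    ⊤R   : ∀ {Γ} → Γ ⊢⁺ ⊤'
    &L₁  : ∀ {c A B G} → c [ ⟨ A ⟩ ] ⊢⁺ G → c [ ⟨ A & B ⟩ ] ⊢⁺ G
    &L₂  : ∀ {c A B G} → c [ ⟨ B ⟩ ] ⊢⁺ G → c [ ⟨ A & B ⟩ ] ⊢⁺ G
    &R   : ∀ {Γ A B} → Γ ⊢⁺ A → Γ ⊢⁺ B → Γ ⊢⁺ A & B
    ⊕L   : ∀ {c A B G} → c [ ⟨ A ⟩ ] ⊢⁺ G → c [ ⟨ B ⟩ ] ⊢⁺ G → c [ ⟨ A ⊕ B ⟩ ] ⊢⁺ G
    ⊕R₁  : ∀ {Γ A B} → Γ ⊢⁺ A → Γ ⊢⁺ A ⊕ B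
    ⊕R₂  : ∀ {Γ A B} → Γ ⊢⁺ B → Γ ⊢⁺ A ⊕ B
    ⊗L   : ∀ {c A B G} → c [ ⟨ A ⟩ ,, ⟨ B ⟩ ] ⊢⁺ G → c [ ⟨ A ⊗ B ⟩ ] ⊢⁺ G
    ⊗R   : ∀ {Γ Δ A B} → Γ ⊢⁺ A → Δ ⊢⁺ B → Γ ,, Δ ⊢⁺ A ⊗ B
    ⇾L   : ∀ {c Δ A B G} → Δ ⊢⁺ A → c [ ⟨ B ⟩ ] ⊢⁺ G → c [ Δ ,, ⟨ A ⇾ B ⟩ ] ⊢⁺ G
    ⇾R   : ∀ {Γ A B} → ⟨ A ⟩ ,, Γ ⊢⁺ B → Γ ⊢⁺ A ⇾ B
    ⇽L   : ∀ {c Δ A B G} → Δ ⊢⁺ A → c [ ⟨ B ⟩ ] ⊢⁺ G → c [ ⟨ B ⇽ A ⟩ ,, Δ ] ⊢⁺ G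
    ⇽R   : ∀ {Γ A B} → Γ ,, ⟨ A ⟩ ⊢⁺ B → Γ ⊢⁺ B ⇽ A
    !L   : ∀ {c i A G} → c [ ⟨ A ⟩ ] ⊢⁺ G → c [ ⟨ ! i [ A ] ⟩ ] ⊢⁺ G
    !R   : ∀ {Δ i A} → AllS (IsBangUpI i) Δ → Δ ⊢⁺ A → Δ ⊢⁺ ! i [ A ]
    Wk   : ∀ {c G} (b : BangI W) → c [ nothing ] ⊢⁺ G → c [ !S b ] ⊢⁺ G
    Ctr  : ∀ {c G} (b : BangI C) → c [ !S b ,, !S b ] ⊢⁺ G → c [ !S b ] ⊢⁺ G
    Ex₁  : ∀ {c Δ G} (b : BangI E) → c [ Δ ,, !S b ] ⊢⁺ G → c [ !S b ,, Δ ] ⊢⁺ G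
    Ex₂  : ∀ {c Δ G} (b : BangI E) → c [ !S b ,, Δ ] ⊢⁺ G → c [ Δ ,, !S b ] ⊢⁺ G
    A1L  : ∀ {c Δ₂ Δ₃ G} (b : BangI A1) →
           c [ (!S b ,, Δ₂) ,, Δ₃ ] ⊢⁺ G → c [ !S b ,, (Δ₂ ,, Δ₃) ] ⊢⁺ G
    A1M  : ∀ {c Δ₁ Δ₃ G} (b : BangI A1) →
           c [ Δ₁ ,, (!S b ,, Δ₃) ] ⊢⁺ G → c [ (Δ₁ ,, !S b) ,, Δ₃ ] ⊢⁺ G
    A1R  : ∀ {c Δ₁ Δ₂ G} (b : BangI A1) →
           c [ (Δ₁ ,, Δ₂) ,, !S b ] ⊢⁺ G → c [ Δ₁ ,, (Δ₂ ,, !S b) ] ⊢⁺ G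
    A2L  : ∀ {c Δ₂ Δ₃ G} (b : BangI A2) →
           c [ !S b ,, (Δ₂ ,, Δ₃) ] ⊢⁺ G → c [ (!S b ,, Δ₂) ,, Δ₃ ] ⊢⁺ G
    A2M  : ∀ {c Δ₁ Δ₃ G} (b : BangI A2) →
           c [ (Δ₁ ,, !S b) ,, Δ₃ ] ⊢⁺ G → c [ Δ₁ ,, (!S b ,, Δ₃) ] ⊢⁺ G
    A2R  : ∀ {c Δ₁ Δ₂ G} (b : BangI A2) →
           c [ Δ₁ ,, (Δ₂ ,, !S b) ] ⊢⁺ G → c [ (Δ₁ ,, Δ₂) ,, !S b ] ⊢⁺ G

module _ (𝕊 : Signature) where
  open Signature 𝕊

  IsQuest : Label → CFm Label → Set
  IsQuest i F = Σ (CFm Label) λ B → F ≡ ¿ i [ B ]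

  IsQuestUp : Label → CFm Label → Set
  IsQuestUp i F = Σ Label λ j → Σ (CFm Label) λ B → i ≼ j × F ≡ ¿ j [ B ]

  record QuestC (r : SRule) : Set where
    constructor questC
    field
      lab  : Label
      lic  : f lab r ≡ true
      tree : Tree (CFm Label)
      ok   : AllLeaves (IsQuest lab) tree

  ?S : ∀ {r} → QuestC r → Str (CFm Label)
  ?S q = just (QuestC.tree q)

  infix 3 ⊢ᶜ_
  data ⊢ᶜ_ : Str (CFm Label) → Set where
    init : ∀ {A} → ⊢ᶜ ⟨ A ᗮ ⟩ ,, ⟨ A ⟩
    exT  : ∀ {Γ Δ} → ⊢ᶜ Γ ,, Δ → ⊢ᶜ Δ ,, Γ
    asT₁ : ∀ {Γ Δ Θ} → ⊢ᶜ (Γ ,, Δ) ,, Θ → ⊢ᶜ Γ ,, (Δ ,, Θ)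
    asT₂ : ∀ {Γ Δ Θ} → ⊢ᶜ Γ ,, (Δ ,, Θ) → ⊢ᶜ (Γ ,, Δ) ,, Θ
    𝟙R   : ⊢ᶜ ⟨ 𝟙 ⟩
    ⊥R   : ∀ {Γ} → ⊢ᶜ Γ → ⊢ᶜ Γ ,, ⟨ ⊥' ⟩
    ⊤R   : ∀ {Γ} → ⊢ᶜ Γ ,, ⟨ ⊤' ⟩
    ⊗R   : ∀ {Γ Δ A B} → ⊢ᶜ Γ ,, ⟨ A ⟩ → ⊢ᶜ Δ ,, ⟨ B ⟩ → ⊢ᶜ (Δ ,, Γ) ,, ⟨ A ⊗ B ⟩
    ⅋R   : ∀ {Γ A B} → ⊢ᶜ Γ ,, (⟨ A ⟩ ,, ⟨ B ⟩) → ⊢ᶜ Γ ,, ⟨ A ⅋ B ⟩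
    ⊕R₁  : ∀ {Γ A B} → ⊢ᶜ Γ ,, ⟨ A ⟩ → ⊢ᶜ Γ ,, ⟨ A ⊕ B ⟩
    ⊕R₂  : ∀ {Γ A B} → ⊢ᶜ Γ ,, ⟨ B ⟩ → ⊢ᶜ Γ ,, ⟨ A ⊕ B ⟩
    &R   : ∀ {Γ A B} → ⊢ᶜ Γ ,, ⟨ A ⟩ → ⊢ᶜ Γ ,, ⟨ B ⟩ → ⊢ᶜ Γ ,, ⟨ A & B ⟩
    ?R   : ∀ {Γ i A} → ⊢ᶜ Γ ,, ⟨ A ⟩ → ⊢ᶜ Γ ,, ⟨ ¿ i [ A ] ⟩
    !R   : ∀ {Γ i A} → AllS (IsQuestUp i) Γ → ⊢ᶜ Γ ,, ⟨ A ⟩ → ⊢ᶜ Γ ,, ⟨ ! i [ A ] ⟩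
    Wk   : ∀ {c} (q : QuestC W) → ⊢ᶜ c [ nothing ] → ⊢ᶜ c [ ?S q ]
    Ctr  : ∀ {c} (q : QuestC C) → ⊢ᶜ c [ ?S q ,, ?S q ] → ⊢ᶜ c [ ?S q ]
    Ex₁  : ∀ {c Δ} (q : QuestC E) → ⊢ᶜ c [ Δ ,, ?S q ] → ⊢ᶜ c [ ?S q ,, Δ ]
    Ex₂  : ∀ {c Δ} (q : QuestC E) → ⊢ᶜ c [ ?S q ,, Δ ] → ⊢ᶜ c [ Δ ,, ?S q ]
    As1  : ∀ {c Δ₁ Δ₂} (q : QuestC A1) →
           ⊢ᶜ c [ Δ₁ ,, (Δ₂ ,, ?S q) ] → ⊢ᶜ c [ (Δ₁ ,, Δ₂) ,, ?S q ]
    As2  : ∀ {c Δ₁ Δ₂} (q : QuestC A2) →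
           ⊢ᶜ c [ (Δ₁ ,, Δ₂) ,, ?S q ] → ⊢ᶜ c [ Δ₁ ,, (Δ₂ ,, ?S q) ]

{-# OPTIONS --safe #-}
-- A classical formula is an output if it is Â and an input if it is B̂ᗮ; no formula is both,
-- and Â, B̂ᗮ determine A, B.  A binary tree of classical formulas with exactly one output Â,
-- all other maximal subtrees being inputs, can be read cyclically starting from Â as an
-- intuitionistic sequent Γ ⇒ A, and (Γ̂ᗮ, Â) reads as Γ ⇒ A.  By induction on a CacLL_Σ
-- derivation, every reading of its conclusion is provable in acLL⁺_Σ.  Top-level exchange and
-- associativity leave the readings unchanged.  A logical rule becomes a right rule when its
-- principal formula is the output and a left rule when it is an input.  A ?-licensed rule
-- either only rearranges inputs, and becomes the corresponding !-licensed rule, or moves the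
-- output, and becomes a rotated rule: Ex₁ ↔ Ex₂, As1 ↦ A1L/A1M/A1R, As2 ↦ A2L/A2M/A2R.
-- For ⊗R one also needs that a sequent consisting of inputs only is not derivable.
module Submission where

open import Defs
open import Data.Maybe using (just; nothing)
open import Data.Product using (Σ; ∃₂; _×_; _,_)
open import Data.Empty using (⊥-elim)
open import Data.Unit using (tt)
open import Data.Sum using (_⊎_; inj₁; inj₂)
open import Relation.Nullary using (¬_)
open import Relation.Binary.PropositionalEquality using (_≡_; refl; sym; trans; cong; cong₂; subst)

module Readings {L : Set} where

  -- The graphs of A ↦ Â and A ↦ Âᗮ: inverting the translation is then pattern matching.
  data Hat : CFm L → IFm L → Set
  data Hatᗮ : CFm L → IFm L → Set

  data Hat where
    var : ∀ {p} → Hat (pos p) (var p)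
    _&_ : ∀ {F G A B} → Hat F A → Hat G B → Hat (F & G) (A & B)
    _⊕_ : ∀ {F G A B} → Hat F A → Hat G B → Hat (F ⊕ G) (A ⊕ B)
    _⊗_ : ∀ {F G A B} → Hat F A → Hat G B → Hat (F ⊗ G) (A ⊗ B)
    _⇾_ : ∀ {F G A B} → Hatᗮ F A → Hat G B → Hat (F ⅋ G) (A ⇾ B)
    _⇽_ : ∀ {F G A B} → Hat G B → Hatᗮ F A → Hat (G ⅋ F) (B ⇽ A)
    𝟙   : Hat 𝟙 𝟙
    ⊤'  : Hat ⊤' ⊤'
    bang : ∀ {i F A} → Hat F A → Hat (! i [ F ]) (! i [ A ])

  data Hatᗮ where
    var : ∀ {p} → Hatᗮ (neg p) (var p)
    _&_ : ∀ {F G A B} → Hatᗮ F A → Hatᗮ G B → Hatᗮ (F ⊕ G) (A & B)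
    _⊕_ : ∀ {F G A B} → Hatᗮ F A → Hatᗮ G B → Hatᗮ (F & G) (A ⊕ B)
    _⊗_ : ∀ {F G A B} → Hatᗮ F A → Hatᗮ G B → Hatᗮ (G ⅋ F) (A ⊗ B)
    _⇾_ : ∀ {F G A B} → Hat F A → Hatᗮ G B → Hatᗮ (G ⊗ F) (A ⇾ B)
    _⇽_ : ∀ {F G A B} → Hatᗮ G B → Hat F A → Hatᗮ (F ⊗ G) (B ⇽ A)
    𝟙   : Hatᗮ ⊥' 𝟙
    ⊤'  : Hatᗮ 𝟘 ⊤'
    bang : ∀ {i F A} → Hatᗮ F A → Hatᗮ (¿ i [ F ]) (! i [ A ])

  Hat⇒Hatᗮ-ᗮ : ∀ {F A} → Hat F A → Hatᗮ (F ᗮ) A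
  Hatᗮ⇒Hat-ᗮ : ∀ {F A} → Hatᗮ F A → Hat (F ᗮ) A

  Hat⇒Hatᗮ-ᗮ var = var
  Hat⇒Hatᗮ-ᗮ (h & k) = Hat⇒Hatᗮ-ᗮ h & Hat⇒Hatᗮ-ᗮ k
  Hat⇒Hatᗮ-ᗮ (h ⊕ k) = Hat⇒Hatᗮ-ᗮ h ⊕ Hat⇒Hatᗮ-ᗮ k
  Hat⇒Hatᗮ-ᗮ (h ⊗ k) = Hat⇒Hatᗮ-ᗮ h ⊗ Hat⇒Hatᗮ-ᗮ k
  Hat⇒Hatᗮ-ᗮ (h ⇾ k) = Hatᗮ⇒Hat-ᗮ h ⇾ Hat⇒Hatᗮ-ᗮ k
  Hat⇒Hatᗮ-ᗮ (k ⇽ h) = Hat⇒Hatᗮ-ᗮ k ⇽ Hatᗮ⇒Hat-ᗮ h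
  Hat⇒Hatᗮ-ᗮ 𝟙 = 𝟙
  Hat⇒Hatᗮ-ᗮ ⊤' = ⊤'
  Hat⇒Hatᗮ-ᗮ (bang h) = bang (Hat⇒Hatᗮ-ᗮ h)

  Hatᗮ⇒Hat-ᗮ var = var
  Hatᗮ⇒Hat-ᗮ (h & k) = Hatᗮ⇒Hat-ᗮ h & Hatᗮ⇒Hat-ᗮ k
  Hatᗮ⇒Hat-ᗮ (h ⊕ k) = Hatᗮ⇒Hat-ᗮ h ⊕ Hatᗮ⇒Hat-ᗮ k
  Hatᗮ⇒Hat-ᗮ (h ⊗ k) = Hatᗮ⇒Hat-ᗮ h ⊗ Hatᗮ⇒Hat-ᗮ k
  Hatᗮ⇒Hat-ᗮ (h ⇾ k) = Hat⇒Hatᗮ-ᗮ h ⇾ Hatᗮ⇒Hat-ᗮ k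
  Hatᗮ⇒Hat-ᗮ (k ⇽ h) = Hatᗮ⇒Hat-ᗮ k ⇽ Hat⇒Hatᗮ-ᗮ h
  Hatᗮ⇒Hat-ᗮ 𝟙 = 𝟙
  Hatᗮ⇒Hat-ᗮ ⊤' = ⊤'
  Hatᗮ⇒Hat-ᗮ (bang h) = bang (Hatᗮ⇒Hat-ᗮ h)

  hat-Hat : ∀ A → Hat (hat A) A
  hat-Hat (var p) = var
  hat-Hat (A & B) = hat-Hat A & hat-Hat B
  hat-Hat (A ⊕ B) = hat-Hat A ⊕ hat-Hat B
  hat-Hat (A ⊗ B) = hat-Hat A ⊗ hat-Hat B
  hat-Hat (A ⇾ B) = Hat⇒Hatᗮ-ᗮ (hat-Hat A) ⇾ hat-Hat B
  hat-Hat (B ⇽ A) = hat-Hat B ⇽ Hat⇒Hatᗮ-ᗮ (hat-Hat A)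
  hat-Hat 𝟙 = 𝟙
  hat-Hat ⊤' = ⊤'
  hat-Hat (! i [ A ]) = bang (hat-Hat A)

  Hat⇒¬Hatᗮ : ∀ {F A B} → Hat F A → ¬ Hatᗮ F B
  Hat⇒¬Hatᗮ (h & _) (h' ⊕ _) = Hat⇒¬Hatᗮ h h'
  Hat⇒¬Hatᗮ (h ⊕ _) (h' & _) = Hat⇒¬Hatᗮ h h'
  Hat⇒¬Hatᗮ (h ⊗ _) (_ ⇾ h') = Hat⇒¬Hatᗮ h h'
  Hat⇒¬Hatᗮ (_ ⊗ k) (k' ⇽ _) = Hat⇒¬Hatᗮ k k'
  Hat⇒¬Hatᗮ (_ ⇾ k) (k' ⊗ _) = Hat⇒¬Hatᗮ k k'
  Hat⇒¬Hatᗮ (h ⇽ _) (_ ⊗ h') = Hat⇒¬Hatᗮ h h'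

  Hat-functional : ∀ {F A B} → Hat F A → Hat F B → A ≡ B
  Hatᗮ-functional : ∀ {F A B} → Hatᗮ F A → Hatᗮ F B → A ≡ B

  Hat-functional var var = refl
  Hat-functional (h & k) (h' & k') = cong₂ _&_ (Hat-functional h h') (Hat-functional k k')
  Hat-functional (h ⊕ k) (h' ⊕ k') = cong₂ _⊕_ (Hat-functional h h') (Hat-functional k k')
  Hat-functional (h ⊗ k) (h' ⊗ k') = cong₂ _⊗_ (Hat-functional h h') (Hat-functional k k')
  Hat-functional (h ⇾ k) (h' ⇾ k') = cong₂ _⇾_ (Hatᗮ-functional h h') (Hat-functional k k')
  Hat-functional (h ⇾ _) (h' ⇽ _) = ⊥-elim (Hat⇒¬Hatᗮ h' h)
  Hat-functional (k ⇽ _) (h' ⇾ _) = ⊥-elim (Hat⇒¬Hatᗮ k h')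
  Hat-functional (k ⇽ h) (k' ⇽ h') = cong₂ _⇽_ (Hat-functional k k') (Hatᗮ-functional h h')
  Hat-functional 𝟙 𝟙 = refl
  Hat-functional ⊤' ⊤' = refl
  Hat-functional (bang h) (bang h') = cong (! _ [_]) (Hat-functional h h')

  Hatᗮ-functional var var = refl
  Hatᗮ-functional (h & k) (h' & k') = cong₂ _&_ (Hatᗮ-functional h h') (Hatᗮ-functional k k')
  Hatᗮ-functional (h ⊕ k) (h' ⊕ k') = cong₂ _⊕_ (Hatᗮ-functional h h') (Hatᗮ-functional k k')
  Hatᗮ-functional (h ⊗ k) (h' ⊗ k') = cong₂ _⊗_ (Hatᗮ-functional h h') (Hatᗮ-functional k k')
  Hatᗮ-functional (h ⇾ k) (h' ⇾ k') = cong₂ _⇾_ (Hat-functional h h') (Hatᗮ-functional k k')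
  Hatᗮ-functional (_ ⇾ k) (_ ⇽ h') = ⊥-elim (Hat⇒¬Hatᗮ h' k)
  Hatᗮ-functional (_ ⇽ h) (_ ⇾ k') = ⊥-elim (Hat⇒¬Hatᗮ h k')
  Hatᗮ-functional (k ⇽ h) (k' ⇽ h') = cong₂ _⇽_ (Hatᗮ-functional k k') (Hat-functional h h')
  Hatᗮ-functional 𝟙 𝟙 = refl
  Hatᗮ-functional ⊤' ⊤' = refl
  Hatᗮ-functional (bang h) (bang h') = cong (! _ [_]) (Hatᗮ-functional h h')

  data HatᗮT : Tree (CFm L) → Tree (IFm L) → Set where
    leaf : ∀ {F A} → Hatᗮ F A → HatᗮT (leaf F) (leaf A)
    _⊛_  : ∀ {t u g h} → HatᗮT t g → HatᗮT u h → HatᗮT (t ⊛ u) (h ⊛ g)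

  data HatᗮS : Str (CFm L) → Str (IFm L) → Set where
    nothing : HatᗮS nothing nothing
    just    : ∀ {t g} → HatᗮT t g → HatᗮS (just t) (just g)

  hatᗮT-HatᗮT : ∀ t → HatᗮT (hatᗮT t) t
  hatᗮT-HatᗮT (leaf A) = leaf (Hat⇒Hatᗮ-ᗮ (hat-Hat A))
  hatᗮT-HatᗮT (t ⊛ u) = hatᗮT-HatᗮT u ⊛ hatᗮT-HatᗮT t

  hatᗮ-HatᗮS : ∀ Γ → HatᗮS (hatᗮ Γ) Γ
  hatᗮ-HatᗮS nothing = nothing
  hatᗮ-HatᗮS (just t) = just (hatᗮT-HatᗮT t)

  HatᗮS-,, : ∀ {a b x y} → HatᗮS a x → HatᗮS b y → HatᗮS (a ,, b) (y ,, x)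
  HatᗮS-,, nothing nothing = nothing
  HatᗮS-,, nothing (just h) = just h
  HatᗮS-,, (just h) nothing = just h
  HatᗮS-,, (just h) (just k) = just (h ⊛ k)

  HatᗮS-,,⁻ : ∀ a b {z} → HatᗮS (a ,, b) z →
              ∃₂ λ x y → HatᗮS a x × HatᗮS b y × z ≡ y ,, x
  HatᗮS-,,⁻ nothing nothing nothing = nothing , nothing , nothing , nothing , refl
  HatᗮS-,,⁻ nothing (just _) (just h) = nothing , _ , nothing , just h , refl
  HatᗮS-,,⁻ (just _) nothing (just h) = _ , nothing , just h , nothing , refl
  HatᗮS-,,⁻ (just _) (just _) (just (h ⊛ k)) = _ , _ , just h , just k , refl

  -- Reads O t Γ A: t has the single output Â, every subtree hanging off the path to it is an
  -- input, and reading t cyclically from Â, with O the antecedent collected so far, gives Γ ⇒ A.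
  data Reads : Str (IFm L) → Tree (CFm L) → Str (IFm L) → IFm L → Set where
    here  : ∀ {O F A} → Hat F A → Reads O (leaf F) O A
    left  : ∀ {O t u g Γ A} → HatᗮT u g → Reads (O ,, just g) t Γ A → Reads O (t ⊛ u) Γ A
    right : ∀ {O t u g Γ A} → HatᗮT t g → Reads (just g ,, O) u Γ A → Reads O (t ⊛ u) Γ A

  data Reading (O : Str (IFm L)) : Str (CFm L) → Str (IFm L) → IFm L → Set where
    reading : ∀ {t Γ A} → Reads O t Γ A → Reading O (just t) Γ A

  Reads-comm : ∀ {t u Γ A} → Reads nothing (t ⊛ u) Γ A → Reads nothing (u ⊛ t) Γ A
  Reads-comm (left h r)  = right h r
  Reads-comm (right h r) = left h r

  Reads-assoc : ∀ {γ δ θ Γ A} → Reads nothing (γ ⊛ (δ ⊛ θ)) Γ A →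
                Reads nothing ((γ ⊛ δ) ⊛ θ) Γ A
  Reads-assoc (left (hδ ⊛ hθ) r)     = left hθ (left hδ r)
  Reads-assoc (right hγ (left hθ r))  = left hθ (right hγ r)
  Reads-assoc (right hγ (right hδ r)) = right (hγ ⊛ hδ) r

  Reads-assoc⁻ : ∀ {γ δ θ Γ A} → Reads nothing ((γ ⊛ δ) ⊛ θ) Γ A →
                 Reads nothing (γ ⊛ (δ ⊛ θ)) Γ A
  Reads-assoc⁻ (left hθ (left hδ r))  = left (hδ ⊛ hθ) r
  Reads-assoc⁻ (left hθ (right hγ r)) = right hγ (left hθ r)
  Reads-assoc⁻ (right (hγ ⊛ hδ) r)    = right hγ (right hδ r)

  ,,-nothing : ∀ {A : Set} (s : Str A) → s ,, nothing ≡ s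
  ,,-nothing nothing = refl
  ,,-nothing (just _) = refl

  infixl 5 _∘ᶜ_
  _∘ᶜ_ : ∀ {A : Set} → Ctx A → Ctx A → Ctx A
  hole    ∘ᶜ c = c
  (K ◂ D) ∘ᶜ c = (K ∘ᶜ c) ◂ D
  (D ▸ K) ∘ᶜ c = D ▸ (K ∘ᶜ c)

  ∘ᶜ-plug : ∀ {A : Set} (K c : Ctx A) (s : Str A) → (K ∘ᶜ c) [ s ] ≡ K [ c [ s ] ]
  ∘ᶜ-plug hole    c s = refl
  ∘ᶜ-plug (K ◂ D) c s = cong (_,, D) (∘ᶜ-plug K c s)
  ∘ᶜ-plug (D ▸ K) c s = cong (D ,,_) (∘ᶜ-plug K c s)

  ReadsAround : Tree (CFm L) → IFm L → Ctx (IFm L) → Set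
  ReadsAround t A K = ∀ O → Reads O t (K [ O ]) A

  reads-ctx : ∀ {O t Γ A} → Reads O t Γ A →
              Σ (Ctx (IFm L)) λ K → Γ ≡ K [ O ] × ReadsAround t A K
  reads-ctx (here h) = hole , refl , λ _ → here h
  reads-ctx {O} (left {g = g} h r) with reads-ctx r
  ... | K , refl , around = K ∘ᶜ (hole ◂ just g) , sym (∘ᶜ-plug K _ O) , λ O' →
        subst (λ Γ → Reads O' _ Γ _) (sym (∘ᶜ-plug K _ O')) (left h (around (O' ,, just g)))
  reads-ctx {O} (right {g = g} h r) with reads-ctx r
  ... | K , refl , around = K ∘ᶜ (just g ▸ hole) , sym (∘ᶜ-plug K _ O) , λ O' →
        subst (λ Γ → Reads O' _ Γ _) (sym (∘ᶜ-plug K _ O')) (right h (around (just g ,, O')))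

  reads-with-inputˡ : ∀ {u A K O X Y} → ReadsAround u A K → HatᗮS X Y →
                      Reading O (X ,, just u) (K [ Y ,, O ]) A
  reads-with-inputˡ {O = O} around nothing = reading (around O)
  reads-with-inputˡ {O = O} around (just {g = g} h) = reading (right h (around (just g ,, O)))

  reads-with-inputʳ : ∀ {u A K O X Y} → ReadsAround u A K → HatᗮS X Y →
                      Reading O (just u ,, X) (K [ O ,, Y ]) A
  reads-with-inputʳ {K = K} {O = O} around nothing =
    subst (λ Γ → Reading O _ (K [ Γ ]) _) (sym (,,-nothing O)) (reading (around O))
  reads-with-inputʳ {O = O} around (just {g = g} h) = reading (left h (around (O ,, just g)))

  -- Contexts without empty siblings, so that plugging a tree into one yields a tree.
  data TCtx : Set where
    hole : TCtx
    _◂_  : TCtx → Tree (CFm L) → TCtx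
    _▸_  : Tree (CFm L) → TCtx → TCtx

  plugᵗ : TCtx → Tree (CFm L) → Tree (CFm L)
  plugᵗ hole     t = t
  plugᵗ (tc ◂ u) t = plugᵗ tc t ⊛ u
  plugᵗ (u ▸ tc) t = u ⊛ plugᵗ tc t

  plugˢ : TCtx → Str (CFm L) → Str (CFm L)
  plugˢ hole     s = s
  plugˢ (tc ◂ u) s = plugˢ tc s ,, just u
  plugˢ (u ▸ tc) s = just u ,, plugˢ tc s

  plugˢ-just : ∀ tc t → plugˢ tc (just t) ≡ just (plugᵗ tc t)
  plugˢ-just hole     t = refl
  plugˢ-just (tc ◂ u) t = cong (_,, just u) (plugˢ-just tc t)
  plugˢ-just (u ▸ tc) t = cong (just u ,,_) (plugˢ-just tc t)

  toTCtx : Ctx (CFm L) → TCtx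
  toTCtx hole           = hole
  toTCtx (c ◂ nothing)  = toTCtx c
  toTCtx (c ◂ just u)   = toTCtx c ◂ u
  toTCtx (nothing ▸ c)  = toTCtx c
  toTCtx (just u ▸ c)   = u ▸ toTCtx c

  toTCtx-plug : ∀ c s → c [ s ] ≡ plugˢ (toTCtx c) s
  toTCtx-plug hole          s = refl
  toTCtx-plug (c ◂ nothing) s = trans (,,-nothing (c [ s ])) (toTCtx-plug c s)
  toTCtx-plug (c ◂ just u)  s = cong (_,, just u) (toTCtx-plug c s)
  toTCtx-plug (nothing ▸ c) s = toTCtx-plug c s
  toTCtx-plug (just u ▸ c)  s = cong (just u ,,_) (toTCtx-plug c s)

  record HoleInput (P : Str (CFm L) → Str (CFm L)) (t : Tree (CFm L)) (G : Str (IFm L)) : Set where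
    constructor holeInput
    field
      {g}        : Tree (IFm L)
      translates : HatᗮT t g
      ctx        : Ctx (IFm L)
      G≡         : G ≡ ctx [ just g ]
      refill     : ∀ {s g'} → HatᗮS s g' → HatᗮS (P s) (ctx [ g' ])

  HatᗮT-plugᵗ⁻ : ∀ tc {t G} → HatᗮT (plugᵗ tc t) G → HoleInput (plugˢ tc) t (just G)
  HatᗮT-plugᵗ⁻ hole h = holeInput h hole refl (λ k → k)
  HatᗮT-plugᵗ⁻ (tc ◂ u) (h ⊛ k) with HatᗮT-plugᵗ⁻ tc h
  ... | holeInput t~ Cc G≡ refill =
        holeInput t~ (just _ ▸ Cc) (cong (just _ ,,_) G≡) (λ k' → HatᗮS-,, (refill k') (just k))
  HatᗮT-plugᵗ⁻ (u ▸ tc) (h ⊛ k) with HatᗮT-plugᵗ⁻ tc k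
  ... | holeInput t~ Cc G≡ refill =
        holeInput t~ (Cc ◂ just _) (cong (_,, just _) G≡) (λ k' → HatᗮS-,, (just h) (refill k'))

  HatᗮS-plug⁻ : ∀ c {t G} → HatᗮS (c [ just t ]) G → HoleInput (c [_]) t G
  HatᗮS-plug⁻ c {t} {G} h
    with subst (λ s → HatᗮS s G) (trans (toTCtx-plug c (just t)) (plugˢ-just (toTCtx c) t)) h
  ... | just h' with HatᗮT-plugᵗ⁻ (toTCtx c) h'
  ... | holeInput t~ Cc G≡ refill =
        holeInput t~ Cc G≡ λ {s} k →
          subst (λ s' → HatᗮS s' _) (sym (toTCtx-plug c s)) (refill k)

  Reading-◂ : ∀ {O S u g Γ A} → HatᗮT u g → Reading (O ,, just g) S Γ A →
              Reading O (S ,, just u) Γ A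
  Reading-◂ h (reading r) = reading (left h r)

  Reading-▸ : ∀ {O S u g Γ A} → HatᗮT u g → Reading (just g ,, O) S Γ A →
              Reading O (just u ,, S) Γ A
  Reading-▸ h (reading r) = reading (right h r)

  -- Where the output of a reading of P (just t) lies: either t consists of inputs, and may be
  -- replaced by any other inputs, or the output lies in t, and t may be replaced by any tree
  -- read from the same O₀.
  record InputAt (O : Str (IFm L)) (P : Str (CFm L) → Str (CFm L))
                 (t : Tree (CFm L)) (Γ : Str (IFm L)) (A : IFm L) : Set where
    constructor inputAt
    field
      {g}        : Tree (IFm L)
      translates : HatᗮT t g
      ctx        : Ctx (IFm L)
      Γ≡         : Γ ≡ ctx [ just g ]
      refill     : ∀ {s g'} → HatᗮS s g' → Reading O (P s) (ctx [ g' ]) A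

  record OutputAt (O : Str (IFm L)) (P : Str (CFm L) → Str (CFm L))
                  (t : Tree (CFm L)) (Γ : Str (IFm L)) (A : IFm L) : Set where
    constructor outputAt
    field
      {O₀}   : Str (IFm L)
      reads  : Reads O₀ t Γ A
      refill : ∀ {t' Γ'} → Reads O₀ t' Γ' A → Reading O (P (just t')) Γ' A

  Located : Str (IFm L) → (Str (CFm L) → Str (CFm L)) →
            Tree (CFm L) → Str (IFm L) → IFm L → Set
  Located O P t Γ A = InputAt O P t Γ A ⊎ OutputAt O P t Γ A

  locateᵗ : ∀ tc {O t Γ A} → Reads O (plugᵗ tc t) Γ A → Located O (plugˢ tc) t Γ A
  locateᵗ hole r = inj₂ (outputAt r reading)
  locateᵗ (tc ◂ u) (left h r) with locateᵗ tc r
  ... | inj₁ (inputAt t~ Cc Γ≡ refill) = inj₁ (inputAt t~ Cc Γ≡ λ k → Reading-◂ h (refill k))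
  ... | inj₂ (outputAt r₀ refill)     = inj₂ (outputAt r₀ λ r' → Reading-◂ h (refill r'))
  locateᵗ (u ▸ tc) (right h r) with locateᵗ tc r
  ... | inj₁ (inputAt t~ Cc Γ≡ refill) = inj₁ (inputAt t~ Cc Γ≡ λ k → Reading-▸ h (refill k))
  ... | inj₂ (outputAt r₀ refill)     = inj₂ (outputAt r₀ λ r' → Reading-▸ h (refill r'))
  locateᵗ (tc ◂ u) {O} (right h r) with HatᗮT-plugᵗ⁻ tc h | reads-ctx r
  ... | holeInput t~ Cc G≡ refill | K , refl , around =
    inj₁ (inputAt t~ (K ∘ᶜ (Cc ◂ O))
            (trans (cong (λ s → K [ s ,, O ]) G≡) (sym (∘ᶜ-plug K (Cc ◂ O) _)))
            (λ {_} {g'} k → subst (λ Γ → Reading O _ Γ _) (sym (∘ᶜ-plug K (Cc ◂ O) g'))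
                                  (reads-with-inputˡ {K = K} around (refill k))))
  locateᵗ (u ▸ tc) {O} (left h r) with HatᗮT-plugᵗ⁻ tc h | reads-ctx r
  ... | holeInput t~ Cc G≡ refill | K , refl , around =
    inj₁ (inputAt t~ (K ∘ᶜ (O ▸ Cc))
            (trans (cong (λ s → K [ O ,, s ]) G≡) (sym (∘ᶜ-plug K (O ▸ Cc) _)))
            (λ {_} {g'} k → subst (λ Γ → Reading O _ Γ _) (sym (∘ᶜ-plug K (O ▸ Cc) g'))
                                  (reads-with-inputʳ {K = K} around (refill k))))

  toTCtx-Reading : ∀ c {O s Γ A} → Reading O (plugˢ (toTCtx c) s) Γ A →
                   Reading O (c [ s ]) Γ A
  toTCtx-Reading c {O} {s} = subst (λ S → Reading O S _ _) (sym (toTCtx-plug c s))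

  locate : ∀ c {O t Γ A} → Reading O (c [ just t ]) Γ A → Located O (c [_]) t Γ A
  locate c {O} {t} ρ
    with subst (λ S → Reading O S _ _) (trans (toTCtx-plug c (just t)) (plugˢ-just (toTCtx c) t)) ρ
  ... | reading r with locateᵗ (toTCtx c) r
  ... | inj₁ (inputAt t~ Cc Γ≡ refill) =
        inj₁ (inputAt t~ Cc Γ≡ (λ k → toTCtx-Reading c (refill k)))
  ... | inj₂ (outputAt r₀ refill) =
        inj₂ (outputAt r₀ (λ r' → toTCtx-Reading c (refill r')))

module _ (𝕊 : Signature) where
  open Signature 𝕊
  open Readings {Label}

  infix 3 ⊢_ _⊢_

  ⊢_ : Str (CFm Label) → Set
  ⊢_ = ⊢ᶜ_ 𝕊

  _⊢_ : Str (IFm Label) → IFm Label → Set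
  _⊢_ = _⊢⁺_ 𝕊

  AllLeaves-HatᗮT : ∀ {P : CFm Label → Set} {Q : IFm Label → Set} →
                    (∀ {F X} → P F → Hatᗮ F X → Q X) →
                    ∀ {t g} → AllLeaves P t → HatᗮT t g → AllLeaves Q g
  AllLeaves-HatᗮT f (leafₐ p) (leaf h) = leafₐ (f p h)
  AllLeaves-HatᗮT f (nodeₐ p q) (h ⊛ k) =
    nodeₐ (AllLeaves-HatᗮT f q k) (AllLeaves-HatᗮT f p h)

  IsQuest⇒IsBangI : ∀ {l F X} → IsQuest 𝕊 l F → Hatᗮ F X → IsBangI 𝕊 l X
  IsQuest⇒IsBangI (_ , refl) (bang {A = X} _) = X , refl

  IsQuestUp⇒IsBangUpI : ∀ {l F X} → IsQuestUp 𝕊 l F → Hatᗮ F X → IsBangUpI 𝕊 l X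
  IsQuestUp⇒IsBangUpI (j , _ , l≼j , refl) (bang {A = X} _) = j , X , l≼j , refl

  AllS-IsQuestUp⇒IsBangUpI : ∀ {l S y} → AllS (IsQuestUp 𝕊 l) S → HatᗮS S y →
                             AllS (IsBangUpI 𝕊 l) y
  AllS-IsQuestUp⇒IsBangUpI _ nothing  = tt
  AllS-IsQuestUp⇒IsBangUpI p (just h) = AllLeaves-HatᗮT IsQuestUp⇒IsBangUpI p h

  toBangI : ∀ {r} (q : QuestC 𝕊 r) {g} → HatᗮT (QuestC.tree q) g → BangI 𝕊 r
  toBangI q {g} h =
    bangI (QuestC.lab q) (QuestC.lic q) g (AllLeaves-HatᗮT IsQuest⇒IsBangI (QuestC.ok q) h)

  ¬Reads-¿ : ∀ {l O t Γ A} → AllLeaves (IsQuest 𝕊 l) t → ¬ Reads O t Γ A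
  ¬Reads-¿ (leafₐ (_ , refl)) (here ())
  ¬Reads-¿ (nodeₐ p _) (left _ r) = ¬Reads-¿ p r
  ¬Reads-¿ (nodeₐ _ q) (right _ r) = ¬Reads-¿ q r

  ⊬-HatᗮS : ∀ {S γ} → ⊢ S → ¬ HatᗮS S γ
  ⊬-HatᗮS (init {F}) (just (leaf h ⊛ leaf k)) = Hat⇒¬Hatᗮ (Hatᗮ⇒Hat-ᗮ k) h
  ⊬-HatᗮS (exT {Γ} {Δ} d) h with HatᗮS-,,⁻ Δ Γ h
  ... | _ , _ , hΔ , hΓ , _ = ⊬-HatᗮS d (HatᗮS-,, hΓ hΔ)
  ⊬-HatᗮS (asT₁ {Γ} {Δ} {Θ} d) h with HatᗮS-,,⁻ Γ (Δ ,, Θ) h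
  ... | _ , _ , hΓ , hΔΘ , _ with HatᗮS-,,⁻ Δ Θ hΔΘ
  ... | _ , _ , hΔ , hΘ , _ = ⊬-HatᗮS d (HatᗮS-,, (HatᗮS-,, hΓ hΔ) hΘ)
  ⊬-HatᗮS (asT₂ {Γ} {Δ} {Θ} d) h with HatᗮS-,,⁻ (Γ ,, Δ) Θ h
  ... | _ , _ , hΓΔ , hΘ , _ with HatᗮS-,,⁻ Γ Δ hΓΔ
  ... | _ , _ , hΓ , hΔ , _ = ⊬-HatᗮS d (HatᗮS-,, hΓ (HatᗮS-,, hΔ hΘ))
  ⊬-HatᗮS 𝟙R (just (leaf ()))
  ⊬-HatᗮS (⊥R {Γ} d) h with HatᗮS-,,⁻ Γ _ h
  ... | _ , _ , hΓ , _ , _ = ⊬-HatᗮS d hΓ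
  ⊬-HatᗮS (⊤R {Γ}) h with HatᗮS-,,⁻ Γ _ h
  ... | _ , _ , _ , just (leaf ()) , _
  ⊬-HatᗮS (⊗R {Γ} {Δ} d₁ d₂) h with HatᗮS-,,⁻ (Δ ,, Γ) _ h
  ... | _ , _ , hΔΓ , just (leaf k) , _ with HatᗮS-,,⁻ Δ Γ hΔΓ | k
  ... | _ , _ , _ , hΓ , _ | _ ⇾ a = ⊬-HatᗮS d₁ (HatᗮS-,, hΓ (just (leaf a)))
  ... | _ , _ , hΔ , _ , _ | b ⇽ _ = ⊬-HatᗮS d₂ (HatᗮS-,, hΔ (just (leaf b)))
  ⊬-HatᗮS (⅋R {Γ} d) h with HatᗮS-,,⁻ Γ _ h
  ... | _ , _ , hΓ , just (leaf (b ⊗ a)) , _ =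
        ⊬-HatᗮS d (HatᗮS-,, hΓ (just (leaf a ⊛ leaf b)))
  ⊬-HatᗮS (⊕R₁ {Γ} d) h with HatᗮS-,,⁻ Γ _ h
  ... | _ , _ , hΓ , just (leaf (a & _)) , _ = ⊬-HatᗮS d (HatᗮS-,, hΓ (just (leaf a)))
  ⊬-HatᗮS (⊕R₂ {Γ} d) h with HatᗮS-,,⁻ Γ _ h
  ... | _ , _ , hΓ , just (leaf (_ & b)) , _ = ⊬-HatᗮS d (HatᗮS-,, hΓ (just (leaf b)))
  ⊬-HatᗮS (&R {Γ} d₁ _) h with HatᗮS-,,⁻ Γ _ h
  ... | _ , _ , hΓ , just (leaf (a ⊕ _)) , _ = ⊬-HatᗮS d₁ (HatᗮS-,, hΓ (just (leaf a)))
  ⊬-HatᗮS (?R {Γ} d) h with HatᗮS-,,⁻ Γ _ h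
  ... | _ , _ , hΓ , just (leaf (bang a)) , _ = ⊬-HatᗮS d (HatᗮS-,, hΓ (just (leaf a)))
  ⊬-HatᗮS (!R {Γ} _ _) h with HatᗮS-,,⁻ Γ _ h
  ... | _ , _ , _ , just (leaf ()) , _
  ⊬-HatᗮS (Wk {c} q d) h with HatᗮS-plug⁻ c h
  ... | holeInput _ _ _ refill = ⊬-HatᗮS d (refill nothing)
  ⊬-HatᗮS (Ctr {c} q d) h with HatᗮS-plug⁻ c h
  ... | holeInput hq _ _ refill = ⊬-HatᗮS d (refill (just (hq ⊛ hq)))
  ⊬-HatᗮS (Ex₁ {c} {nothing} q d) h = ⊬-HatᗮS d h
  ⊬-HatᗮS (Ex₁ {c} {just _} q d) h with HatᗮS-plug⁻ c h
  ... | holeInput (hq ⊛ hδ) _ _ refill = ⊬-HatᗮS d (refill (just (hδ ⊛ hq)))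
  ⊬-HatᗮS (Ex₂ {c} {nothing} q d) h = ⊬-HatᗮS d h
  ⊬-HatᗮS (Ex₂ {c} {just _} q d) h with HatᗮS-plug⁻ c h
  ... | holeInput (hδ ⊛ hq) _ _ refill = ⊬-HatᗮS d (refill (just (hq ⊛ hδ)))
  ⊬-HatᗮS (As1 {c} {nothing} q d) h = ⊬-HatᗮS d h
  ⊬-HatᗮS (As1 {c} {just _} {nothing} q d) h = ⊬-HatᗮS d h
  ⊬-HatᗮS (As1 {c} {just _} {just _} q d) h with HatᗮS-plug⁻ c h
  ... | holeInput ((h₁ ⊛ h₂) ⊛ hq) _ _ refill =
        ⊬-HatᗮS d (refill (just (h₁ ⊛ (h₂ ⊛ hq))))
  ⊬-HatᗮS (As2 {c} {nothing} q d) h = ⊬-HatᗮS d h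
  ⊬-HatᗮS (As2 {c} {just _} {nothing} q d) h = ⊬-HatᗮS d h
  ⊬-HatᗮS (As2 {c} {just _} {just _} q d) h with HatᗮS-plug⁻ c h
  ... | holeInput (h₁ ⊛ (h₂ ⊛ hq)) _ _ refill =
        ⊬-HatᗮS d (refill (just ((h₁ ⊛ h₂) ⊛ hq)))

  Translatable : Str (CFm Label) → Set
  Translatable S = ∀ {Γ A} → Reading nothing S Γ A → Γ ⊢ A

  from-ctx : ∀ {O t Γ A} → Reads O t Γ A →
             (∀ K → ReadsAround t A K → K [ O ] ⊢ A) → Γ ⊢ A
  from-ctx r k with reads-ctx r
  ... | K , refl , around = k K around

  Reading-▸ˢ : ∀ {S y u Γ A} → HatᗮS S y → Reads y u Γ A →
               Reading nothing (S ,, just u) Γ A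
  Reading-▸ˢ nothing  r = reading r
  Reading-▸ˢ (just h) r = reading (right h r)

  Reading-input : ∀ {t A u g} K → ReadsAround t A K → HatᗮT u g →
                  Reading nothing (just t ,, just u) (K [ just g ]) A
  Reading-input _ around h = reading (left h (around (just _)))

  data Principal (S : Str (CFm Label)) (F : CFm Label) (Γ : Str (IFm Label)) (A : IFm Label) :
                 Set where
    output : Hat F A → HatᗮS S Γ → Principal S F Γ A
    input  : ∀ {X t} → S ≡ just t → Hatᗮ F X → Reads ⟨ X ⟩ t Γ A → Principal S F Γ A

  principal : ∀ S {F Γ A} → Reading nothing (S ,, ⟨ F ⟩) Γ A → Principal S F Γ A
  principal nothing  (reading (here h))          = output h nothing
  principal (just _) (reading (right k (here h))) = output h (just k)
  principal (just _) (reading (left (leaf k) r))  = input refl k r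

  init-translatable : ∀ F → Translatable (⟨ F ᗮ ⟩ ,, ⟨ F ⟩)
  init-translatable F (reading (left (leaf h) (here k))) with Hat-functional (Hatᗮ⇒Hat-ᗮ h) k
  ... | refl = init
  init-translatable F (reading (right (leaf h) (here k))) with Hatᗮ-functional h (Hat⇒Hatᗮ-ᗮ k)
  ... | refl = init

  exT-translatable : ∀ Γ Δ → Translatable (Γ ,, Δ) → Translatable (Δ ,, Γ)
  exT-translatable nothing  nothing  ih = ih
  exT-translatable nothing  (just _) ih = ih
  exT-translatable (just _) nothing  ih = ih
  exT-translatable (just _) (just _) ih (reading r) = ih (reading (Reads-comm r))

  asT₁-translatable : ∀ Γ Δ Θ → Translatable ((Γ ,, Δ) ,, Θ) → Translatable (Γ ,, (Δ ,, Θ))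
  asT₁-translatable nothing  _        _        ih = ih
  asT₁-translatable (just _) nothing  _        ih = ih
  asT₁-translatable (just _) (just _) nothing  ih = ih
  asT₁-translatable (just _) (just _) (just _) ih (reading r) = ih (reading (Reads-assoc r))

  asT₂-translatable : ∀ Γ Δ Θ → Translatable (Γ ,, (Δ ,, Θ)) → Translatable ((Γ ,, Δ) ,, Θ)
  asT₂-translatable nothing  _        _        ih = ih
  asT₂-translatable (just _) nothing  _        ih = ih
  asT₂-translatable (just _) (just _) nothing  ih = ih
  asT₂-translatable (just _) (just _) (just _) ih (reading r) = ih (reading (Reads-assoc⁻ r))

  𝟙R-translatable : Translatable ⟨ 𝟙 ⟩
  𝟙R-translatable (reading (here 𝟙)) = 𝟙R

  ⊥R-translatable : ∀ Γ → Translatable Γ → Translatable (Γ ,, ⟨ ⊥' ⟩)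
  ⊥R-translatable Γ ih ρ with principal Γ ρ
  ... | input refl 𝟙 r = from-ctx r λ K around → 𝟙L {c = K} (ih (reading (around nothing)))

  ⊤R-translatable : ∀ Γ → Translatable (Γ ,, ⟨ ⊤' ⟩)
  ⊤R-translatable Γ ρ with principal Γ ρ
  ... | output ⊤' _ = ⊤R

  ⅋R-translatable : ∀ Γ {A B} → Translatable (Γ ,, (⟨ A ⟩ ,, ⟨ B ⟩)) →
                    Translatable (Γ ,, ⟨ A ⅋ B ⟩)
  ⅋R-translatable Γ ih ρ with principal Γ ρ
  ... | output (a ⇾ b) hΓ = ⇾R (ih (Reading-▸ˢ hΓ (right (leaf a) (here b))))
  ... | output (a ⇽ b) hΓ = ⇽R (ih (Reading-▸ˢ hΓ (left (leaf b) (here a))))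
  ... | input refl (b ⊗ a) r = from-ctx r λ K around →
        ⊗L {c = K} (ih (Reading-input K around (leaf a ⊛ leaf b)))

  ⊕R₁-translatable : ∀ Γ {A B} → Translatable (Γ ,, ⟨ A ⟩) →
                     Translatable (Γ ,, ⟨ A ⊕ B ⟩)
  ⊕R₁-translatable Γ ih ρ with principal Γ ρ
  ... | output (a ⊕ _) hΓ = ⊕R₁ (ih (Reading-▸ˢ hΓ (here a)))
  ... | input refl (a & _) r = from-ctx r λ K around →
        &L₁ {c = K} (ih (Reading-input K around (leaf a)))

  ⊕R₂-translatable : ∀ Γ {A B} → Translatable (Γ ,, ⟨ B ⟩) →
                     Translatable (Γ ,, ⟨ A ⊕ B ⟩)
  ⊕R₂-translatable Γ ih ρ with principal Γ ρ
  ... | output (_ ⊕ b) hΓ = ⊕R₂ (ih (Reading-▸ˢ hΓ (here b)))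
  ... | input refl (_ & b) r = from-ctx r λ K around →
        &L₂ {c = K} (ih (Reading-input K around (leaf b)))

  &R-translatable : ∀ Γ {A B} → Translatable (Γ ,, ⟨ A ⟩) → Translatable (Γ ,, ⟨ B ⟩) →
                    Translatable (Γ ,, ⟨ A & B ⟩)
  &R-translatable Γ ih₁ ih₂ ρ with principal Γ ρ
  ... | output (a & b) hΓ = &R (ih₁ (Reading-▸ˢ hΓ (here a))) (ih₂ (Reading-▸ˢ hΓ (here b)))
  ... | input refl (a ⊕ b) r = from-ctx r λ K around →
        ⊕L {c = K} (ih₁ (Reading-input K around (leaf a))) (ih₂ (Reading-input K around (leaf b)))

  ?R-translatable : ∀ Γ {i A} → Translatable (Γ ,, ⟨ A ⟩) →
                    Translatable (Γ ,, ⟨ ¿ i [ A ] ⟩)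
  ?R-translatable Γ ih ρ with principal Γ ρ
  ... | input refl (bang a) r = from-ctx r λ K around →
        !L {c = K} (ih (Reading-input K around (leaf a)))

  !R-translatable : ∀ Γ {i A} → AllS (IsQuestUp 𝕊 i) Γ → Translatable (Γ ,, ⟨ A ⟩) →
                    Translatable (Γ ,, ⟨ ! i [ A ] ⟩)
  !R-translatable Γ quests ih ρ with principal Γ ρ
  ... | output (bang a) hΓ = !R (AllS-IsQuestUp⇒IsBangUpI quests hΓ) (ih (Reading-▸ˢ hΓ (here a)))

  -- The premise that does not receive the output would consist of inputs only.
  ⊗R-input : ∀ Δ Γ {t A B Z Γ' G} →
             Δ ,, Γ ≡ just t → Hatᗮ (A ⊗ B) Z → Reads ⟨ Z ⟩ t Γ' G →
             ⊢ (Γ ,, ⟨ A ⟩) → ⊢ (Δ ,, ⟨ B ⟩) →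
             Translatable (Γ ,, ⟨ A ⟩) → Translatable (Δ ,, ⟨ B ⟩) → Γ' ⊢ G
  ⊗R-input nothing  (just _) refl (b ⇾ a) r _ _ ih₁ ih₂ = from-ctx r λ K around →
    ⇾L {c = K} {Δ = nothing} (ih₂ (reading (here b))) (ih₁ (Reading-input K around (leaf a)))
  ⊗R-input nothing  (just _) refl (b ⇽ _) _ _ d₂ _ _ = ⊥-elim (⊬-HatᗮS d₂ (just (leaf b)))
  ⊗R-input (just _) nothing  refl (_ ⇾ a) _ d₁ _ _ _ = ⊥-elim (⊬-HatᗮS d₁ (just (leaf a)))
  ⊗R-input (just _) nothing  refl (b ⇽ a) r _ _ ih₁ ih₂ = from-ctx r λ K around →
    ⇽L {c = K} {Δ = nothing} (ih₁ (reading (here a))) (ih₂ (Reading-input K around (leaf b)))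
  ⊗R-input (just _) (just _) refl (_ ⇾ a) (left hγ _) d₁ _ _ _ =
    ⊥-elim (⊬-HatᗮS d₁ (just (hγ ⊛ leaf a)))
  ⊗R-input (just _) (just _) refl (b ⇾ a) (right hδ r) _ _ ih₁ ih₂ = from-ctx r λ K around →
    ⇾L {c = K} {Δ = just _} (ih₂ (reading (right hδ (here b))))
                            (ih₁ (Reading-input K around (leaf a)))
  ⊗R-input (just _) (just _) refl (b ⇽ a) (left hγ r) _ _ ih₁ ih₂ = from-ctx r λ K around →
    ⇽L {c = K} {Δ = just _} (ih₁ (reading (right hγ (here a))))
                            (ih₂ (Reading-input K around (leaf b)))
  ⊗R-input (just _) (just _) refl (b ⇽ _) (right hδ _) _ d₂ _ _ =
    ⊥-elim (⊬-HatᗮS d₂ (just (hδ ⊛ leaf b)))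

  ⊗R-translatable : ∀ Γ Δ {A B} → ⊢ (Γ ,, ⟨ A ⟩) → ⊢ (Δ ,, ⟨ B ⟩) →
                    Translatable (Γ ,, ⟨ A ⟩) → Translatable (Δ ,, ⟨ B ⟩) →
                    Translatable ((Δ ,, Γ) ,, ⟨ A ⊗ B ⟩)
  ⊗R-translatable Γ Δ d₁ d₂ ih₁ ih₂ ρ with principal (Δ ,, Γ) ρ
  ... | input eq h r = ⊗R-input Δ Γ eq h r d₁ d₂ ih₁ ih₂
  ... | output (a ⊗ b) hΔΓ with HatᗮS-,,⁻ Δ Γ hΔΓ
  ... | _ , _ , hΔ , hΓ , refl =
        ⊗R (ih₁ (Reading-▸ˢ hΓ (here a))) (ih₂ (Reading-▸ˢ hΔ (here b)))

  Wk-translatable : ∀ c q → Translatable (c [ nothing ]) → Translatable (c [ ?S 𝕊 {W} q ])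
  Wk-translatable c q ih ρ with locate c ρ
  ... | inj₁ (inputAt hq Cc refl refill) = Wk {c = Cc} (toBangI q hq) (ih (refill nothing))
  ... | inj₂ (outputAt r _) = ⊥-elim (¬Reads-¿ (QuestC.ok q) r)

  Ctr-translatable : ∀ c q → Translatable (c [ ?S 𝕊 {C} q ,, ?S 𝕊 q ]) →
                     Translatable (c [ ?S 𝕊 q ])
  Ctr-translatable c q ih ρ with locate c ρ
  ... | inj₁ (inputAt hq Cc refl refill) = Ctr {c = Cc} (toBangI q hq) (ih (refill (just (hq ⊛ hq))))
  ... | inj₂ (outputAt r _) = ⊥-elim (¬Reads-¿ (QuestC.ok q) r)

  Ex₁-translatable : ∀ c Δ q → Translatable (c [ Δ ,, ?S 𝕊 {E} q ]) →
                     Translatable (c [ ?S 𝕊 q ,, Δ ])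
  Ex₁-translatable c nothing q ih = ih
  Ex₁-translatable c (just _) q ih ρ with locate c ρ
  ... | inj₁ (inputAt (hq ⊛ hδ) Cc refl refill) =
        Ex₂ {c = Cc} {Δ = just _} (toBangI q hq) (ih (refill (just (hδ ⊛ hq))))
  ... | inj₂ (outputAt (left _ r) _) = ⊥-elim (¬Reads-¿ (QuestC.ok q) r)
  ... | inj₂ (outputAt {O₀} (right hq r) refill) = from-ctx r λ K around →
        Ex₁ {c = K} {Δ = O₀} (toBangI q hq) (ih (refill (left hq (around (O₀ ,, just _)))))

  Ex₂-translatable : ∀ c Δ q → Translatable (c [ ?S 𝕊 {E} q ,, Δ ]) →
                     Translatable (c [ Δ ,, ?S 𝕊 q ])
  Ex₂-translatable c nothing q ih = ih
  Ex₂-translatable c (just _) q ih ρ with locate c ρ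
  ... | inj₁ (inputAt (hδ ⊛ hq) Cc refl refill) =
        Ex₁ {c = Cc} {Δ = just _} (toBangI q hq) (ih (refill (just (hq ⊛ hδ))))
  ... | inj₂ (outputAt (right _ r) _) = ⊥-elim (¬Reads-¿ (QuestC.ok q) r)
  ... | inj₂ (outputAt {O₀} (left hq r) refill) = from-ctx r λ K around →
        Ex₂ {c = K} {Δ = O₀} (toBangI q hq) (ih (refill (right hq (around (just _ ,, O₀)))))

  As1-translatable : ∀ c Δ₁ Δ₂ q → Translatable (c [ Δ₁ ,, (Δ₂ ,, ?S 𝕊 {A1} q) ]) →
                     Translatable (c [ (Δ₁ ,, Δ₂) ,, ?S 𝕊 q ])
  As1-translatable c nothing  _        q ih = ih
  As1-translatable c (just _) nothing  q ih = ih
  As1-translatable c (just _) (just _) q ih ρ with locate c ρ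
  ... | inj₁ (inputAt ((h₁ ⊛ h₂) ⊛ hq) Cc refl refill) =
        A1L {c = Cc} {Δ₂ = just _} {Δ₃ = just _} (toBangI q hq)
            (ih (refill (just (h₁ ⊛ (h₂ ⊛ hq)))))
  ... | inj₂ (outputAt (right _ r) _) = ⊥-elim (¬Reads-¿ (QuestC.ok q) r)
  ... | inj₂ (outputAt {O₀} (left hq (left h₂ r)) refill) = from-ctx r λ K around →
        A1M {c = K} {Δ₁ = O₀} {Δ₃ = just _} (toBangI q hq)
            (ih (refill (left (h₂ ⊛ hq) (around (O₀ ,, just _)))))
  ... | inj₂ (outputAt {O₀} (left hq (right h₁ r)) refill) = from-ctx r λ K around →
        A1R {c = K} {Δ₁ = just _} {Δ₂ = O₀} (toBangI q hq)
            (ih (refill (right h₁ (left hq (around ((just _ ,, O₀) ,, just _))))))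

  As2-translatable : ∀ c Δ₁ Δ₂ q → Translatable (c [ (Δ₁ ,, Δ₂) ,, ?S 𝕊 {A2} q ]) →
                     Translatable (c [ Δ₁ ,, (Δ₂ ,, ?S 𝕊 q) ])
  As2-translatable c nothing  _        q ih = ih
  As2-translatable c (just _) nothing  q ih = ih
  As2-translatable c (just _) (just _) q ih ρ with locate c ρ
  ... | inj₁ (inputAt (h₁ ⊛ (h₂ ⊛ hq)) Cc refl refill) =
        A2L {c = Cc} {Δ₂ = just _} {Δ₃ = just _} (toBangI q hq)
            (ih (refill (just ((h₁ ⊛ h₂) ⊛ hq))))
  ... | inj₂ (outputAt (right _ (right _ r)) _) = ⊥-elim (¬Reads-¿ (QuestC.ok q) r)
  ... | inj₂ (outputAt {O₀} (left (h₂ ⊛ hq) r) refill) = from-ctx r λ K around →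
        A2M {c = K} {Δ₁ = O₀} {Δ₃ = just _} (toBangI q hq)
            (ih (refill (left hq (left h₂ (around ((O₀ ,, just _) ,, just _))))))
  ... | inj₂ (outputAt {O₀} (right h₁ (left hq r)) refill) = from-ctx r λ K around →
        A2R {c = K} {Δ₁ = just _} {Δ₂ = O₀} (toBangI q hq)
            (ih (refill (left hq (right h₁ (around (just _ ,, (O₀ ,, just _)))))))

  translate : ∀ {S} → ⊢ S → Translatable S
  translate (init {F})              = init-translatable F
  translate (exT {Γ} {Δ} d)         = exT-translatable Γ Δ (translate d)
  translate (asT₁ {Γ} {Δ} {Θ} d)    = asT₁-translatable Γ Δ Θ (translate d)
  translate (asT₂ {Γ} {Δ} {Θ} d)    = asT₂-translatable Γ Δ Θ (translate d)
  translate 𝟙R                      = 𝟙R-translatable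
  translate (⊥R {Γ} d)              = ⊥R-translatable Γ (translate d)
  translate (⊤R {Γ})                = ⊤R-translatable Γ
  translate (⊗R {Γ} {Δ} d₁ d₂)      =
    ⊗R-translatable Γ Δ d₁ d₂ (translate d₁) (translate d₂)
  translate (⅋R {Γ} d)              = ⅋R-translatable Γ (translate d)
  translate (⊕R₁ {Γ} d)             = ⊕R₁-translatable Γ (translate d)
  translate (⊕R₂ {Γ} d)             = ⊕R₂-translatable Γ (translate d)
  translate (&R {Γ} d₁ d₂)          = &R-translatable Γ (translate d₁) (translate d₂)
  translate (?R {Γ} d)              = ?R-translatable Γ (translate d)
  translate (!R {Γ} quests d)       = !R-translatable Γ quests (translate d)
  translate (Wk {c} q d)            = Wk-translatable c q (translate d)
  translate (Ctr {c} q d)           = Ctr-translatable c q (translate d)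
  translate (Ex₁ {c} {Δ} q d)       = Ex₁-translatable c Δ q (translate d)
  translate (Ex₂ {c} {Δ} q d)       = Ex₂-translatable c Δ q (translate d)
  translate (As1 {c} {Δ₁} {Δ₂} q d) = As1-translatable c Δ₁ Δ₂ q (translate d)
  translate (As2 {c} {Δ₁} {Δ₂} q d) = As2-translatable c Δ₁ Δ₂ q (translate d)

theorem3p2 : (𝕊 : Signature) (Γ : Str (IFm (Signature.Label 𝕊))) (A : IFm (Signature.Label 𝕊)) →
    ⊢ᶜ_ 𝕊 (hatᗮ Γ ,, ⟨ hat A ⟩) → _⊢⁺_ 𝕊 Γ A
theorem3p2 𝕊 Γ A d = translate 𝕊 d (Reading-▸ˢ 𝕊 (hatᗮ-HatᗮS Γ) (here (hat-Hat A)))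
  where open Readings
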